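{- Let $N$ be a nonzero integer. An $N$-tiling $\mathbf{M}\colon\mathcal{I}\times\mathcal{J}\to\mathbb{Z}$ is tame if and only if there are sequences $(r_i)_{i\in\mathcal{I}^*}$ and $(s_j)_{j\in\mathcal{J}^*}$ of elements of $\tfrac1N\mathbb{Z}$ such that \[ m_{i-1,j}+m_{i+1,j}=r_im_{i,j}\ \ (i\in\mathcal{I}^*,\ j\in\mathcal{J}),\qquad m_{i,j-1}+m_{i,j+1}=s_jm_{i,j}\ \ (i\in\mathcal{I},\ j\in\mathcal{J}^*). \] Furthermore, if $\mathbf{M}$ is tame, then $(r_i)$ and $(s_j)$ are the unique sequences of rationals satisfying these recurrence relations.
   Context: Index sets $\mathcal{I},\mathcal{J}$ are sets of consecutive integers of length at least 3 (possibly infinite) containing $0,1$; $\mathcal{I}^*$ is obtained from $\mathcal{I}$ by removing its least element (if any) and its greatest element (if any). An $N$-tiling is a function $\mathbf{M}\colon\mathcal{I}\times\mathcal{J}\to\mathbb{Z}$, $m_{ij}=\mathbf{M}(i,j)$, such that every contiguous $2\times2$ subblock has determinant $N$: $m_{ij}m_{i+1,j+1}-m_{i,j+1}m_{i+1,j}=N$. It is tame if every contiguous $3\times3$ subblock has determinant $0$. -}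

module Defs where

open import Data.Integer using (ℤ; _+_; _-_; _*_; _≤_; +_; 0ℤ; 1ℤ)
open import Data.Maybe using (Maybe; just; nothing)
open import Data.Unit using (⊤)
open import Data.Product using (_×_; ∃)
open import Data.Rational as ℚ using (ℚ)
open import Relation.Binary.PropositionalEquality using (_≡_)

LowerOK : Maybe ℤ → ℤ → Set
LowerOK nothing  i = ⊤
LowerOK (just a) i = a ≤ i

UpperOK : Maybe ℤ → ℤ → Set
UpperOK nothing  i = ⊤
UpperOK (just b) i = i ≤ b

LengthOK : Maybe ℤ → Maybe ℤ → Set
LengthOK (just a) (just b) = a + + 2 ≤ b
LengthOK _        _        = ⊤

-- An index set: a set of consecutive integers {i | lower ≤ i ≤ upper}
-- (bounds optional, i.e. possibly infinite), containing 0 and 1,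
-- of length at least 3.
record IndexSet : Set where
  field
    lower   : Maybe ℤ
    upper   : Maybe ℤ
    has0    : LowerOK lower 0ℤ
    has1    : UpperOK upper 1ℤ
    lenOK   : LengthOK lower upper

open IndexSet public

_∈_ : ℤ → IndexSet → Set
i ∈ I = LowerOK (lower I) i × UpperOK (upper I) i

-- I* : remove least element (if any) and greatest element (if any).
shiftUp : Maybe ℤ → Maybe ℤ
shiftUp nothing  = nothing
shiftUp (just a) = just (a + 1ℤ)

shiftDown : Maybe ℤ → Maybe ℤ
shiftDown nothing  = nothing
shiftDown (just b) = just (b - 1ℤ)

_∈*_ : ℤ → IndexSet → Set
i ∈* I = LowerOK (shiftUp (lower I)) i × UpperOK (shiftDown (upper I)) i

-- Integer matrices indexed by ℤ × ℤ; only the values on I × J matter.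
Matrix : Set
Matrix = ℤ → ℤ → ℤ

det2 : ℤ → ℤ → ℤ → ℤ → ℤ
det2 a b c d = a * d - b * c

IsNTiling : ℤ → IndexSet → IndexSet → Matrix → Set
IsNTiling N I J m =
  ∀ i j → i ∈ I → (i + 1ℤ) ∈ I → j ∈ J → (j + 1ℤ) ∈ J →
  det2 (m i j) (m i (j + 1ℤ)) (m (i + 1ℤ) j) (m (i + 1ℤ) (j + 1ℤ)) ≡ N

det3 : ℤ → ℤ → ℤ → ℤ → ℤ → ℤ → ℤ → ℤ → ℤ → ℤ
det3 a b c d e f g h k =
  a * (e * k - f * h) - b * (d * k - f * g) + c * (d * h - e * g)

Tame : IndexSet → IndexSet → Matrix → Set
Tame I J m =
  ∀ i j → i ∈ I → (i + + 2) ∈ I → j ∈ J → (j + + 2) ∈ J →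
  det3 (m i j)          (m i (j + 1ℤ))          (m i (j + + 2))
       (m (i + 1ℤ) j)   (m (i + 1ℤ) (j + 1ℤ))   (m (i + 1ℤ) (j + + 2))
       (m (i + + 2) j)  (m (i + + 2) (j + 1ℤ))  (m (i + + 2) (j + + 2))
    ≡ 0ℤ

toℚ : ℤ → ℚ
toℚ z = z ℚ./ 1

InOneOverNZ : ℤ → ℚ → Set
InOneOverNZ N q = ∃ λ (k : ℤ) → toℚ N ℚ.* q ≡ toℚ k

RowRec : IndexSet → IndexSet → Matrix → (ℤ → ℚ) → Set
RowRec I J m r =
  ∀ i j → i ∈* I → j ∈ J →
  toℚ (m (i - 1ℤ) j + m (i + 1ℤ) j) ≡ r i ℚ.* toℚ (m i j)

ColRec : IndexSet → IndexSet → Matrix → (ℤ → ℚ) → Set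
ColRec I J m s =
  ∀ i j → i ∈ I → j ∈* J →
  toℚ (m i (j - 1ℤ) + m i (j + 1ℤ)) ≡ s j ℚ.* toℚ (m i j)

{-# OPTIONS --safe #-}
-- Fix i ∈ I* and let a, b, c be the rows i - 1, i, i + 1. The two tiles on the
-- columns j, j + 1 give the Plücker relations N (a + c) = d b on both columns,
-- with d the 2 × 2 minor of a and c there. For any d, N det (a, b, c) is the
-- expansion of the defect row N (a + c) - d b along the 2 × 2 minors of a, b.
-- Those minors on adjacent columns are tiles, equal to N ≠ 0, so a 3 × 3 block
-- on which the relation holds in two adjacent columns is singular iff it holds
-- in the third. Hence tameness carries the relation from the columns 0, 1
-- across all of J with one coefficient d_i, giving r_i = d_i / N; conversely
-- the recurrence with N r_i ∈ ℤ makes every block singular. Row i has a nonzero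
-- entry among m_{i0}, m_{i1} (they lie in a tile), so r_i is unique. The column
-- statements are the row statements for the transpose.
module Submission where

open import Defs
open import Data.Integer using (ℤ; 0ℤ)
open import Data.Rational using (ℚ)
open import Data.Product using (_×_; Σ)
open import Function.Bundles using (_⇔_)
open import Relation.Binary.PropositionalEquality using (_≡_; _≢_)

open import Data.Integer.Base as ℤ using (+_; -[1+_]; 1ℤ; -1ℤ; _+_; _-_; _*_; _≤_; -≤+; +≤+)
import Data.Integer.Properties as ℤ
open import Data.Integer.Tactic.RingSolver using (solve-∀)
import Data.Nat.Base as ℕ
import Data.Nat.Properties as ℕ
open import Data.Maybe.Base using (just; nothing)
open import Data.Product using (_,_; proj₁; proj₂)
open import Data.Sum.Base using (_⊎_; inj₁; inj₂; [_,_]′)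
open import Function.Base using (const)
open import Function.Bundles using (mk⇔)
open import Relation.Binary.PropositionalEquality
  using (refl; sym; trans; cong; cong₂; subst; subst₂; module ≡-Reasoning)
open import Relation.Nullary using (yes; no; contradiction)
import Data.Rational.Base as ℚ
import Data.Rational.Properties as ℚ
import Data.Rational.Unnormalised.Base as ℚᵘ
import Data.Rational.Unnormalised.Properties as ℚᵘ
open import Algebra.Bundles using (CommutativeMonoid)
import Algebra.Properties.CommutativeSemigroup as CommSemigroupProperties

-- With these, IsNTiling and Tame read minor₂ (m i) (m (i + 1)) j ≡ N and
-- minor₃ (m i) (m (i + 1)) (m (i + 2)) j ≡ 0 definitionally.
minor₂ : (ℤ → ℤ) → (ℤ → ℤ) → ℤ → ℤ
minor₂ a b j = det2 (a j) (a (j + 1ℤ)) (b j) (b (j + 1ℤ))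

minor₃ : (ℤ → ℤ) → (ℤ → ℤ) → (ℤ → ℤ) → ℤ → ℤ
minor₃ a b c j =
  det3 (a j) (a (j + 1ℤ)) (a (j + + 2))
       (b j) (b (j + 1ℤ)) (b (j + + 2))
       (c j) (c (j + 1ℤ)) (c (j + + 2))

i-1+1≡i : ∀ i → i - 1ℤ + 1ℤ ≡ i
i-1+1≡i = solve-∀

i+1-1≡i : ∀ i → i + 1ℤ - 1ℤ ≡ i
i+1-1≡i = solve-∀

i+1+1≡i+2 : ∀ i → i + 1ℤ + 1ℤ ≡ i + + 2
i+1+1≡i+2 = solve-∀

i-1+2≡i+1 : ∀ i → i - 1ℤ + + 2 ≡ i + 1ℤ
i-1+2≡i+1 = solve-∀

i+2-1≡i+1 : ∀ i → i + + 2 - 1ℤ ≡ i + 1ℤ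
i+2-1≡i+1 = solve-∀

i≤i+1 : ∀ i → i ≤ i + 1ℤ
i≤i+1 i = ℤ.i≤i+j i 1ℤ

-- Recurrence j is the paper's recurrence a + c = (d / N) b at column j,
-- with the denominator cleared.
module ThreeRows (N : ℤ) (a b c : ℤ → ℤ) (d : ℤ) where

  Recurrence : ℤ → Set
  Recurrence j = N * (a j + c j) ≡ d * b j

  defect : ℤ → ℤ
  defect j = N * (a j + c j) - d * b j

  ab₁₂ ab₀₂ : ℤ → ℤ
  ab₁₂ j = det2 (a (j + 1ℤ)) (a (j + + 2)) (b (j + 1ℤ)) (b (j + + 2))
  ab₀₂ j = det2 (a j) (a (j + + 2)) (b j) (b (j + + 2))

  -- Laplace expansion along the last row of det3 (a, b, N (a + c) - d b),
  -- to which the multiples of a and b contribute nothing.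
  N*minor₃≡defect-expansion : ∀ j → N * minor₃ a b c j ≡
    defect j * ab₁₂ j - defect (j + 1ℤ) * ab₀₂ j + defect (j + + 2) * minor₂ a b j
  N*minor₃≡defect-expansion j =
    expansion (a j) (a (j + 1ℤ)) (a (j + + 2)) (b j) (b (j + 1ℤ)) (b (j + + 2))
              (c j) (c (j + 1ℤ)) (c (j + + 2)) N d
    where
    expansion : ∀ a₀ a₁ a₂ b₀ b₁ b₂ c₀ c₁ c₂ N d →
      N * (a₀ * (b₁ * c₂ - b₂ * c₁) - a₁ * (b₀ * c₂ - b₂ * c₀) + a₂ * (b₀ * c₁ - b₁ * c₀)) ≡
        (N * (a₀ + c₀) - d * b₀) * (a₁ * b₂ - a₂ * b₁)
      - (N * (a₁ + c₁) - d * b₁) * (a₀ * b₂ - a₂ * b₀)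
      + (N * (a₂ + c₂) - d * b₂) * (a₀ * b₁ - a₁ * b₀)
    expansion = solve-∀

  recurrence⇒defect≡0 : ∀ {j} → Recurrence j → defect j ≡ 0ℤ
  recurrence⇒defect≡0 = ℤ.i≡j⇒i-j≡0

  defect≡0⇒recurrence : ∀ {j} → defect j ≡ 0ℤ → Recurrence j
  defect≡0⇒recurrence = ℤ.i-j≡0⇒i≡j _ _

  module _ .{{_ : ℤ.NonZero N}} where
    open ≡-Reasoning

    recurrence-extendʳ : ∀ {j} → minor₂ a b j ≡ N → minor₃ a b c j ≡ 0ℤ →
      Recurrence j → Recurrence (j + 1ℤ) → Recurrence (j + + 2)
    recurrence-extendʳ {j} tile block r₀ r₁ =
      defect≡0⇒recurrence (sym (ℤ.*-cancelʳ-≡ 0ℤ (defect (j + + 2)) N (begin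
        0ℤ * N                                  ≡⟨ ℤ.*-zeroʳ N ⟨
        N * 0ℤ                                  ≡⟨ cong (N *_) block ⟨
        N * minor₃ a b c j                      ≡⟨ N*minor₃≡defect-expansion j ⟩
        defect j * ab₁₂ j - defect (j + 1ℤ) * ab₀₂ j + defect (j + + 2) * minor₂ a b j
          ≡⟨ cong₂ (λ e₀ e₁ → e₀ * ab₁₂ j - e₁ * ab₀₂ j + defect (j + + 2) * minor₂ a b j)
                   (recurrence⇒defect≡0 r₀) (recurrence⇒defect≡0 r₁) ⟩
        0ℤ + defect (j + + 2) * minor₂ a b j    ≡⟨ ℤ.+-identityˡ _ ⟩
        defect (j + + 2) * minor₂ a b j         ≡⟨ cong (defect (j + + 2) *_) tile ⟩
        defect (j + + 2) * N                    ∎)))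

    recurrence-extendˡ : ∀ {j} → minor₂ a b (j + 1ℤ) ≡ N → minor₃ a b c j ≡ 0ℤ →
      Recurrence (j + 1ℤ) → Recurrence (j + + 2) → Recurrence j
    recurrence-extendˡ {j} tile block r₁ r₂ =
      defect≡0⇒recurrence (sym (ℤ.*-cancelʳ-≡ 0ℤ (defect j) N (begin
        0ℤ * N                                  ≡⟨ ℤ.*-zeroʳ N ⟨
        N * 0ℤ                                  ≡⟨ cong (N *_) block ⟨
        N * minor₃ a b c j                      ≡⟨ N*minor₃≡defect-expansion j ⟩
        defect j * ab₁₂ j - defect (j + 1ℤ) * ab₀₂ j + defect (j + + 2) * minor₂ a b j
          ≡⟨ cong₂ (λ e₁ e₂ → defect j * ab₁₂ j - e₁ * ab₀₂ j + e₂ * minor₂ a b j)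
                   (recurrence⇒defect≡0 r₁) (recurrence⇒defect≡0 r₂) ⟩
        defect j * ab₁₂ j - 0ℤ + 0ℤ             ≡⟨ trans (ℤ.+-identityʳ _) (ℤ.+-identityʳ _) ⟩
        defect j * ab₁₂ j                       ≡⟨ cong (defect j *_) ab₁₂≡N ⟩
        defect j * N                            ∎)))
      where
      ab₁₂≡N : ab₁₂ j ≡ N
      ab₁₂≡N = subst (λ k → det2 (a (j + 1ℤ)) (a k) (b (j + 1ℤ)) (b k) ≡ N) (i+1+1≡i+2 j) tile

    recurrences⇒minor₃≡0 : ∀ {j} → Recurrence j → Recurrence (j + 1ℤ) → Recurrence (j + + 2) →
      minor₃ a b c j ≡ 0ℤ
    recurrences⇒minor₃≡0 {j} r₀ r₁ r₂ = ℤ.*-cancelˡ-≡ N _ 0ℤ (begin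
      N * minor₃ a b c j                      ≡⟨ N*minor₃≡defect-expansion j ⟩
      defect j * ab₁₂ j - defect (j + 1ℤ) * ab₀₂ j + defect (j + + 2) * minor₂ a b j
        ≡⟨ cong₂ (λ e₀ e₁ → e₀ * ab₁₂ j - e₁ * ab₀₂ j + defect (j + + 2) * minor₂ a b j)
                 (recurrence⇒defect≡0 r₀) (recurrence⇒defect≡0 r₁) ⟩
      0ℤ + defect (j + + 2) * minor₂ a b j
        ≡⟨ cong (λ e₂ → 0ℤ + e₂ * minor₂ a b j) (recurrence⇒defect≡0 r₂) ⟩
      0ℤ                                      ≡⟨ ℤ.*-zeroʳ N ⟨
      N * 0ℤ                                  ∎)

tiles⇒recurrence : ∀ {N} a b c j → minor₂ a b j ≡ N → minor₂ b c j ≡ N →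
  let open ThreeRows N a b c (minor₂ a c j) in Recurrence j × Recurrence (j + 1ℤ)
tiles⇒recurrence {N} a b c j ab bc =
  column (plücker₀ (a j) (a (j + 1ℤ)) (b j) (b (j + 1ℤ)) (c j) (c (j + 1ℤ))) ,
  column (plücker₁ (a j) (a (j + 1ℤ)) (b j) (b (j + 1ℤ)) (c j) (c (j + 1ℤ)))
  where
  open ≡-Reasoning
  column : ∀ {aₖ bₖ cₖ} → minor₂ b c j * aₖ + minor₂ a b j * cₖ ≡ minor₂ a c j * bₖ →
    N * (aₖ + cₖ) ≡ minor₂ a c j * bₖ
  column {aₖ} {bₖ} {cₖ} plücker = begin
    N * (aₖ + cₖ)                           ≡⟨ ℤ.*-distribˡ-+ N aₖ cₖ ⟩
    N * aₖ + N * cₖ                         ≡⟨ cong₂ (λ x y → x * aₖ + y * cₖ) bc ab ⟨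
    minor₂ b c j * aₖ + minor₂ a b j * cₖ   ≡⟨ plücker ⟩
    minor₂ a c j * bₖ                       ∎
  plücker₀ : ∀ a₀ a₁ b₀ b₁ c₀ c₁ →
    (b₀ * c₁ - b₁ * c₀) * a₀ + (a₀ * b₁ - a₁ * b₀) * c₀ ≡ (a₀ * c₁ - a₁ * c₀) * b₀
  plücker₀ = solve-∀
  plücker₁ : ∀ a₀ a₁ b₀ b₁ c₀ c₁ →
    (b₀ * c₁ - b₁ * c₀) * a₁ + (a₀ * b₁ - a₁ * b₀) * c₁ ≡ (a₀ * c₁ - a₁ * c₀) * b₁
  plücker₁ = solve-∀

LowerOK-mono : ∀ l {x y} → x ≤ y → LowerOK l x → LowerOK l y
LowerOK-mono nothing  _   _   = _
LowerOK-mono (just _) x≤y a≤x = ℤ.≤-trans a≤x x≤y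

UpperOK-antimono : ∀ u {x y} → x ≤ y → UpperOK u y → UpperOK u x
UpperOK-antimono nothing  _   _   = _
UpperOK-antimono (just _) x≤y y≤b = ℤ.≤-trans x≤y y≤b

∈-between : ∀ (J : IndexSet) {x y z} → x ∈ J → z ∈ J → x ≤ y → y ≤ z → y ∈ J
∈-between J (lx , _) (_ , uz) x≤y y≤z =
  LowerOK-mono (lower J) x≤y lx , UpperOK-antimono (upper J) y≤z uz

0≤1 : 0ℤ ≤ 1ℤ
0≤1 = +≤+ ℕ.z≤n

0∈ : ∀ J → 0ℤ ∈ J
0∈ J = has0 J , UpperOK-antimono (upper J) 0≤1 (has1 J)

1∈ : ∀ J → 1ℤ ∈ J
1∈ J = LowerOK-mono (lower J) 0≤1 (has0 J) , has1 J

∈-inner : ∀ (J : IndexSet) {j} → j ∈ J → (j + + 2) ∈ J → (j + 1ℤ) ∈ J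
∈-inner J {j} j∈J j+2∈J =
  ∈-between J j∈J j+2∈J (i≤i+1 j) (subst (j + 1ℤ ≤_) (i+1+1≡i+2 j) (i≤i+1 (j + 1ℤ)))

∈*⇒neighbours∈ : ∀ I {i} → i ∈* I → (i - 1ℤ) ∈ I × (i + 1ℤ) ∈ I
∈*⇒neighbours∈ I {i} (l , u) =
  (lower-1 (lower I) l , UpperOK-antimono (upper I) i-1≤i+1 (upper+1 (upper I) u)) ,
  (LowerOK-mono (lower I) i-1≤i+1 (lower-1 (lower I) l) , upper+1 (upper I) u)
  where
  i-1≤i+1 : i - 1ℤ ≤ i + 1ℤ
  i-1≤i+1 = ℤ.≤-trans (ℤ.i-j≤i i 1ℤ) (i≤i+1 i)
  lower-1 : ∀ l → LowerOK (shiftUp l) i → LowerOK l (i - 1ℤ)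
  lower-1 nothing  _ = _
  lower-1 (just a) a+1≤i = subst (_≤ i - 1ℤ) (i+1-1≡i a) (ℤ.+-monoˡ-≤ -1ℤ a+1≤i)
  upper+1 : ∀ u → UpperOK (shiftDown u) i → UpperOK u (i + 1ℤ)
  upper+1 nothing  _ = _
  upper+1 (just b) i≤b-1 = subst (i + 1ℤ ≤_) (i-1+1≡i b) (ℤ.+-monoˡ-≤ 1ℤ i≤b-1)

∈*⇒∈ : ∀ I {i} → i ∈* I → i ∈ I
∈*⇒∈ I {i} i∈* = let (i-1∈ , i+1∈) = ∈*⇒neighbours∈ I i∈* in
  ∈-between I i-1∈ i+1∈ (ℤ.i-j≤i i 1ℤ) (i≤i+1 i)

∈*-middle : ∀ I {i} → i ∈ I → (i + + 2) ∈ I → (i + 1ℤ) ∈* I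
∈*-middle I {i} (l , _) (_ , u) = lower+1 (lower I) l , upper-1 (upper I) u
  where
  lower+1 : ∀ l → LowerOK l i → LowerOK (shiftUp l) (i + 1ℤ)
  lower+1 nothing  _ = _
  lower+1 (just a) a≤i = ℤ.+-monoˡ-≤ 1ℤ a≤i
  upper-1 : ∀ u → UpperOK u (i + + 2) → UpperOK (shiftDown u) (i + 1ℤ)
  upper-1 nothing  _ = _
  upper-1 (just b) i+2≤b = subst (_≤ b - 1ℤ) (i+2-1≡i+1 i) (ℤ.+-monoˡ-≤ -1ℤ i+2≤b)

ℤ-induction : (Q : ℤ → Set) → Q 0ℤ →
  (∀ {j} → 0ℤ ≤ j → Q j → Q (j + 1ℤ)) →
  (∀ {j} → j + 1ℤ ≤ 0ℤ → Q (j + 1ℤ) → Q j) →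
  ∀ j → Q j
ℤ-induction Q q₀ up down (+ ℕ.zero)    = q₀
ℤ-induction Q q₀ up down (+ ℕ.suc n)   =
  subst Q (cong +_ (ℕ.+-comm n 1)) (up (+≤+ ℕ.z≤n) (ℤ-induction Q q₀ up down (+ n)))
ℤ-induction Q q₀ up down -[1+ ℕ.zero ]  = down ℤ.≤-refl q₀
ℤ-induction Q q₀ up down -[1+ ℕ.suc n ] = down -≤+ (ℤ-induction Q q₀ up down -[1+ n ])

∈-induction : ∀ (J : IndexSet) (P : ℤ → Set) → P 0ℤ → P 1ℤ →
  (∀ j → j ∈ J → (j + + 2) ∈ J → P j → P (j + 1ℤ) → P (j + + 2)) →
  (∀ j → j ∈ J → (j + + 2) ∈ J → P (j + 1ℤ) → P (j + + 2) → P j) →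
  ∀ j → j ∈ J → P j
∈-induction J P p₀ p₁ stepʳ stepˡ j = proj₁ (ℤ-induction Edge (const p₀ , const p₁) up down j)
  where
  Edge : ℤ → Set
  Edge j = (j ∈ J → P j) × ((j + 1ℤ) ∈ J → P (j + 1ℤ))

  up : ∀ {j} → 0ℤ ≤ j → Edge j → Edge (j + 1ℤ)
  up {j} 0≤j (pⱼ , pⱼ₊₁) = pⱼ₊₁ , λ j+1+1∈J →
    let j+1∈J = ∈-between J (0∈ J) j+1+1∈J (ℤ.≤-trans 0≤j (i≤i+1 j)) (i≤i+1 (j + 1ℤ))
        j∈J   = ∈-between J (0∈ J) j+1∈J 0≤j (i≤i+1 j)
    in subst P (sym (i+1+1≡i+2 j))
         (stepʳ j j∈J (subst (_∈ J) (i+1+1≡i+2 j) j+1+1∈J) (pⱼ j∈J) (pⱼ₊₁ j+1∈J))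

  down : ∀ {j} → j + 1ℤ ≤ 0ℤ → Edge (j + 1ℤ) → Edge j
  down {j} j+1≤0 (pⱼ₊₁ , pⱼ₊₂) = (λ j∈J →
    let j+1+1∈J = ∈-between J j∈J (1∈ J) (ℤ.≤-trans (i≤i+1 j) (i≤i+1 (j + 1ℤ)))
                    (ℤ.+-monoˡ-≤ 1ℤ j+1≤0)
        j+1∈J   = ∈-between J j∈J j+1+1∈J (i≤i+1 j) (i≤i+1 (j + 1ℤ))
    in stepˡ j j∈J (subst (_∈ J) (i+1+1≡i+2 j) j+1+1∈J)
         (pⱼ₊₁ j+1∈J) (subst P (i+1+1≡i+2 j) (pⱼ₊₂ j+1+1∈J))) , pⱼ₊₁

module ℚ* = CommSemigroupProperties
  (CommutativeMonoid.commutativeSemigroup ℚ.*-1-commutativeMonoid)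

toℚ-injective : ∀ {x y} → toℚ x ≡ toℚ y → x ≡ y
toℚ-injective {x} {y} eq = begin
  x          ≡⟨ ℤ.*-identityʳ x ⟨
  x * 1ℤ     ≡⟨ ℚᵘ.drop-*≡* (ℚ.fromℚᵘ-injective {x ℚᵘ./ 1} {y ℚᵘ./ 1} eq) ⟩
  y * 1ℤ     ≡⟨ ℤ.*-identityʳ y ⟩
  y          ∎
  where open ≡-Reasoning

toℚ-nonZero : ∀ {x} → x ≢ 0ℤ → ℚ.NonZero (toℚ x)
toℚ-nonZero x≢0 = ℚ.≢-nonZero (λ eq → x≢0 (toℚ-injective eq))

toℚ-* : ∀ x y → toℚ (x * y) ≡ toℚ x ℚ.* toℚ y
toℚ-* x y = ℚ.toℚᵘ-injective (begin
  ℚ.toℚᵘ (toℚ (x * y))                  ≈⟨ ℚ.toℚᵘ-fromℚᵘ (x * y ℚᵘ./ 1) ⟩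
  (x ℚᵘ./ 1) ℚᵘ.* (y ℚᵘ./ 1)
    ≈⟨ ℚᵘ.*-cong (ℚ.toℚᵘ-fromℚᵘ (x ℚᵘ./ 1)) (ℚ.toℚᵘ-fromℚᵘ (y ℚᵘ./ 1)) ⟨
  ℚ.toℚᵘ (toℚ x) ℚᵘ.* ℚ.toℚᵘ (toℚ y)   ≈⟨ ℚ.toℚᵘ-homo-* (toℚ x) (toℚ y) ⟨
  ℚ.toℚᵘ (toℚ x ℚ.* toℚ y)              ∎)
  where open ℚᵘ.≃-Reasoning

*-1/-cancelʳ : ∀ p q .{{_ : ℚ.NonZero q}} → p ℚ.* q ℚ.* ℚ.1/ q ≡ p
*-1/-cancelʳ p q = begin
  p ℚ.* q ℚ.* ℚ.1/ q     ≡⟨ ℚ.*-assoc p q (ℚ.1/ q) ⟩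
  p ℚ.* (q ℚ.* ℚ.1/ q)   ≡⟨ cong (p ℚ.*_) (ℚ.*-inverseʳ q) ⟩
  p ℚ.* ℚ.1ℚ             ≡⟨ ℚ.*-identityʳ p ⟩
  p                      ∎
  where open ≡-Reasoning

*-cancelʳ : ∀ {p p′} q .{{_ : ℚ.NonZero q}} → p ℚ.* q ≡ p′ ℚ.* q → p ≡ p′
*-cancelʳ {p} {p′} q eq = begin
  p                    ≡⟨ *-1/-cancelʳ p q ⟨
  p ℚ.* q ℚ.* ℚ.1/ q   ≡⟨ cong (ℚ._* ℚ.1/ q) eq ⟩
  p′ ℚ.* q ℚ.* ℚ.1/ q  ≡⟨ *-1/-cancelʳ p′ q ⟩
  p′                   ∎
  where open ≡-Reasoning

cleared⇒rational : ∀ n x d y .{{_ : ℚ.NonZero (toℚ n)}} → n * x ≡ d * y →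
  toℚ x ≡ (toℚ d ℚ.* ℚ.1/ toℚ n) ℚ.* toℚ y
cleared⇒rational n x d y eq = begin
  toℚ x                                  ≡⟨ *-1/-cancelʳ (toℚ x) (toℚ n) ⟨
  toℚ x ℚ.* toℚ n ℚ.* ℚ.1/ toℚ n         ≡⟨ cong (ℚ._* ℚ.1/ toℚ n) (ℚ.*-comm (toℚ x) (toℚ n)) ⟩
  toℚ n ℚ.* toℚ x ℚ.* ℚ.1/ toℚ n         ≡⟨ cong (ℚ._* ℚ.1/ toℚ n) (toℚ-* n x) ⟨
  toℚ (n * x) ℚ.* ℚ.1/ toℚ n             ≡⟨ cong (λ z → toℚ z ℚ.* ℚ.1/ toℚ n) eq ⟩
  toℚ (d * y) ℚ.* ℚ.1/ toℚ n             ≡⟨ cong (ℚ._* ℚ.1/ toℚ n) (toℚ-* d y) ⟩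
  toℚ d ℚ.* toℚ y ℚ.* ℚ.1/ toℚ n         ≡⟨ ℚ*.xy∙z≈xz∙y (toℚ d) (toℚ y) (ℚ.1/ toℚ n) ⟩
  toℚ d ℚ.* ℚ.1/ toℚ n ℚ.* toℚ y         ∎
  where open ≡-Reasoning

rational⇒cleared : ∀ n x k y {r} → toℚ n ℚ.* r ≡ toℚ k → toℚ x ≡ r ℚ.* toℚ y → n * x ≡ k * y
rational⇒cleared n x k y {r} nr≡k x≡ry = toℚ-injective (begin
  toℚ (n * x)                 ≡⟨ toℚ-* n x ⟩
  toℚ n ℚ.* toℚ x             ≡⟨ cong (toℚ n ℚ.*_) x≡ry ⟩
  toℚ n ℚ.* (r ℚ.* toℚ y)     ≡⟨ ℚ.*-assoc (toℚ n) r (toℚ y) ⟨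
  toℚ n ℚ.* r ℚ.* toℚ y       ≡⟨ cong (ℚ._* toℚ y) nr≡k ⟩
  toℚ k ℚ.* toℚ y             ≡⟨ toℚ-* k y ⟨
  toℚ (k * y)                 ∎)
  where open ≡-Reasoning

d/n∈1/nℤ : ∀ n d .{{_ : ℚ.NonZero (toℚ n)}} → InOneOverNZ n (toℚ d ℚ.* ℚ.1/ toℚ n)
d/n∈1/nℤ n d = d , (begin
  toℚ n ℚ.* (toℚ d ℚ.* ℚ.1/ toℚ n)   ≡⟨ ℚ*.x∙yz≈y∙xz (toℚ n) (toℚ d) (ℚ.1/ toℚ n) ⟩
  toℚ d ℚ.* (toℚ n ℚ.* ℚ.1/ toℚ n)   ≡⟨ cong (toℚ d ℚ.*_) (ℚ.*-inverseʳ (toℚ n)) ⟩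
  toℚ d ℚ.* ℚ.1ℚ                     ≡⟨ ℚ.*-identityʳ (toℚ d) ⟩
  toℚ d                              ∎)
  where open ≡-Reasoning

det2≢0⇒first-row≢0 : ∀ {a b c d} → det2 a b c d ≢ 0ℤ → a ≢ 0ℤ ⊎ b ≢ 0ℤ
det2≢0⇒first-row≢0 {a} {b} det≢0 with a ℤ.≟ 0ℤ | b ℤ.≟ 0ℤ
... | no a≢0   | _        = inj₁ a≢0
... | yes _    | no b≢0   = inj₂ b≢0
... | yes refl | yes refl = contradiction refl det≢0

transpose : Matrix → Matrix
transpose m i j = m j i

IsNTiling-transpose : ∀ {N} I J m → IsNTiling N I J m → IsNTiling N J I (transpose m)
IsNTiling-transpose I J m tiling i j i∈ i+1∈ j∈ j+1∈ =
  trans (det2-transpose (m j i) (m j (i + 1ℤ)) (m (j + 1ℤ) i) (m (j + 1ℤ) (i + 1ℤ)))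
        (tiling j i j∈ j+1∈ i∈ i+1∈)
  where
  det2-transpose : ∀ a b c d → a * d - c * b ≡ a * d - b * c
  det2-transpose = solve-∀

Tame-transpose : ∀ I J m → Tame I J m → Tame J I (transpose m)
Tame-transpose I J m tame i j i∈ i+2∈ j∈ j+2∈ =
  trans (det3-transpose (m j i) (m j (i + 1ℤ)) (m j (i + + 2))
                        (m (j + 1ℤ) i) (m (j + 1ℤ) (i + 1ℤ)) (m (j + 1ℤ) (i + + 2))
                        (m (j + + 2) i) (m (j + + 2) (i + 1ℤ)) (m (j + + 2) (i + + 2)))
        (tame j i j∈ j+2∈ i∈ i+2∈)
  where
  det3-transpose : ∀ a b c d e f g h k →
    a * (e * k - h * f) - d * (b * k - h * c) + g * (b * f - e * c) ≡
    a * (e * k - f * h) - b * (d * k - f * g) + c * (d * h - e * g)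
  det3-transpose = solve-∀

ColRec⇒RowRecᵀ : ∀ I J m s → ColRec I J m s → RowRec J I (transpose m) s
ColRec⇒RowRecᵀ I J m s col j i j∈* i∈ = col i j i∈ j∈*

RowRecᵀ⇒ColRec : ∀ I J m s → RowRec J I (transpose m) s → ColRec I J m s
RowRecᵀ⇒ColRec I J m s rec i j i∈ j∈* = rec j i j∈* i∈

module MiddleRow (I J : IndexSet) (m : Matrix) where

  tile-above : ∀ {N} → IsNTiling N I J m → ∀ {i j} → i ∈* I → j ∈ J → (j + 1ℤ) ∈ J →
    minor₂ (m (i - 1ℤ)) (m i) j ≡ N
  tile-above {N} tiling {i} {j} i∈* j∈ j+1∈ =
    subst (λ k → minor₂ (m (i - 1ℤ)) (m k) j ≡ N) (i-1+1≡i i)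
      (tiling (i - 1ℤ) j (proj₁ (∈*⇒neighbours∈ I i∈*))
              (subst (_∈ I) (sym (i-1+1≡i i)) (∈*⇒∈ I i∈*)) j∈ j+1∈)

  tile-below : ∀ {N} → IsNTiling N I J m → ∀ {i j} → i ∈* I → j ∈ J → (j + 1ℤ) ∈ J →
    minor₂ (m i) (m (i + 1ℤ)) j ≡ N
  tile-below tiling {i} {j} i∈* = tiling i j (∈*⇒∈ I i∈*) (proj₂ (∈*⇒neighbours∈ I i∈*))

  TameAround : Set
  TameAround = ∀ {i j} → i ∈* I → j ∈ J → (j + + 2) ∈ J →
    minor₃ (m (i - 1ℤ)) (m i) (m (i + 1ℤ)) j ≡ 0ℤ

  Tame⇒TameAround : Tame I J m → TameAround
  Tame⇒TameAround tame {i} {j} i∈* j∈ j+2∈ =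
    let (i-1∈ , i+1∈) = ∈*⇒neighbours∈ I i∈* in
    subst₂ (λ k l → minor₃ (m (i - 1ℤ)) (m k) (m l) j ≡ 0ℤ) (i-1+1≡i i) (i-1+2≡i+1 i)
      (tame (i - 1ℤ) j i-1∈ (subst (_∈ I) (sym (i-1+2≡i+1 i)) i+1∈) j∈ j+2∈)

  TameAround⇒Tame : TameAround → Tame I J m
  TameAround⇒Tame around i j i∈ i+2∈ j∈ j+2∈ =
    subst₂ (λ k l → minor₃ (m k) (m (i + 1ℤ)) (m l) j ≡ 0ℤ) (i+1-1≡i i) (i+1+1≡i+2 i)
      (around (∈*-middle I i∈ i+2∈) j∈ j+2∈)

module RowRecurrences (N : ℤ) (N≢0 : N ≢ 0ℤ) (I J : IndexSet) (m : Matrix)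
                      (tiling : IsNTiling N I J m) where

  open MiddleRow I J m

  private instance
    N-nonZero : ℤ.NonZero N
    N-nonZero = ℤ.≢-nonZero N≢0
    toℚN-nonZero : ℚ.NonZero (toℚ N)
    toℚN-nonZero = toℚ-nonZero N≢0

  module Around (i d : ℤ) = ThreeRows N (m (i - 1ℤ)) (m i) (m (i + 1ℤ)) d

  coefficient : ℤ → ℤ
  coefficient i = minor₂ (m (i - 1ℤ)) (m (i + 1ℤ)) 0ℤ

  Tame⇒recurrence : Tame I J m → ∀ {i} → i ∈* I →
    ∀ j → j ∈ J → Around.Recurrence i (coefficient i) j
  Tame⇒recurrence tame {i} i∈* = ∈-induction J Recurrence (proj₁ base) (proj₂ base) stepʳ stepˡ
    where
    open Around i (coefficient i)
    base : Recurrence 0ℤ × Recurrence 1ℤ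
    base = tiles⇒recurrence (m (i - 1ℤ)) (m i) (m (i + 1ℤ)) 0ℤ
             (tile-above tiling i∈* (0∈ J) (1∈ J)) (tile-below tiling i∈* (0∈ J) (1∈ J))
    stepʳ : ∀ j → j ∈ J → (j + + 2) ∈ J →
      Recurrence j → Recurrence (j + 1ℤ) → Recurrence (j + + 2)
    stepʳ j j∈ j+2∈ = recurrence-extendʳ
      (tile-above tiling i∈* j∈ (∈-inner J j∈ j+2∈))
      (Tame⇒TameAround tame i∈* j∈ j+2∈)
    stepˡ : ∀ j → j ∈ J → (j + + 2) ∈ J →
      Recurrence (j + 1ℤ) → Recurrence (j + + 2) → Recurrence j
    stepˡ j j∈ j+2∈ = recurrence-extendˡ
      (tile-above tiling i∈* (∈-inner J j∈ j+2∈) (subst (_∈ J) (sym (i+1+1≡i+2 j)) j+2∈))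
      (Tame⇒TameAround tame i∈* j∈ j+2∈)

  recurrence⇒minor₃≡0 : ∀ {i} d → (∀ j → j ∈ J → Around.Recurrence i d j) →
    ∀ {j} → j ∈ J → (j + + 2) ∈ J → minor₃ (m (i - 1ℤ)) (m i) (m (i + 1ℤ)) j ≡ 0ℤ
  recurrence⇒minor₃≡0 {i} d rec {j} j∈ j+2∈ =
    recurrences⇒minor₃≡0 (rec j j∈) (rec (j + 1ℤ) (∈-inner J j∈ j+2∈)) (rec (j + + 2) j+2∈)
    where open Around i d

  ratio : ℤ → ℚ
  ratio i = toℚ (coefficient i) ℚ.* ℚ.1/ toℚ N

  ratio∈1/Nℤ : ∀ i → InOneOverNZ N (ratio i)
  ratio∈1/Nℤ i = d/n∈1/nℤ N (coefficient i)

  Tame⇒RowRec : Tame I J m → RowRec I J m ratio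
  Tame⇒RowRec tame i j i∈* j∈ =
    cleared⇒rational N (m (i - 1ℤ) j + m (i + 1ℤ) j) (coefficient i) (m i j)
      (Tame⇒recurrence tame i∈* j j∈)

  RowRec⇒Tame : ∀ r → (∀ i → i ∈* I → InOneOverNZ N (r i)) → RowRec I J m r → Tame I J m
  RowRec⇒Tame r r∈1/Nℤ rec = TameAround⇒Tame λ {i} i∈* →
    let (k , Nr≡k) = r∈1/Nℤ i i∈* in
    recurrence⇒minor₃≡0 k λ j j∈ →
      rational⇒cleared N (m (i - 1ℤ) j + m (i + 1ℤ) j) k (m i j) Nr≡k (rec i j i∈* j∈)

  RowRec-unique : ∀ {r r′} → RowRec I J m r → RowRec I J m r′ → ∀ i → i ∈* I → r i ≡ r′ i
  RowRec-unique {r} {r′} rec rec′ i i∈* = [ agree 0ℤ (0∈ J) , agree 1ℤ (1∈ J) ]′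
    (det2≢0⇒first-row≢0 (λ det≡0 → N≢0 (trans (sym (tile-below tiling i∈* (0∈ J) (1∈ J))) det≡0)))
    where
    agree : ∀ j → j ∈ J → m i j ≢ 0ℤ → r i ≡ r′ i
    agree j j∈ mij≢0 = *-cancelʳ (toℚ (m i j)) {{toℚ-nonZero mij≢0}}
                         (trans (sym (rec i j i∈* j∈)) (rec′ i j i∈* j∈))

theorem3p2 : (N : ℤ) → N ≢ 0ℤ → (I J : IndexSet) → (m : Matrix) →
    IsNTiling N I J m →
    (Tame I J m ⇔
      Σ (ℤ → ℚ) (λ r → Σ (ℤ → ℚ) (λ s →
        (∀ i → i ∈* I → InOneOverNZ N (r i)) ×
        (∀ j → j ∈* J → InOneOverNZ N (s j)) ×
        RowRec I J m r × ColRec I J m s)))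
    ×
    (Tame I J m → (r s r′ s′ : ℤ → ℚ) →
      RowRec I J m r → ColRec I J m s →
      RowRec I J m r′ → ColRec I J m s′ →
      (∀ i → i ∈* I → r i ≡ r′ i) × (∀ j → j ∈* J → s j ≡ s′ j))
theorem3p2 N N≢0 I J m tiling =
  mk⇔ (λ tame → Rows.ratio , Cols.ratio ,
                (λ i _ → Rows.ratio∈1/Nℤ i) , (λ j _ → Cols.ratio∈1/Nℤ j) ,
                Rows.Tame⇒RowRec tame ,
                RowRecᵀ⇒ColRec I J m Cols.ratio (Cols.Tame⇒RowRec (Tame-transpose I J m tame)))
      (λ (r , _ , r∈1/Nℤ , _ , rec , _) → Rows.RowRec⇒Tame r r∈1/Nℤ rec) ,
  -- Uniqueness holds for every N-tiling, tame or not.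
  λ _ _ s _ s′ rec col rec′ col′ →
    Rows.RowRec-unique rec rec′ ,
    Cols.RowRec-unique (ColRec⇒RowRecᵀ I J m s col) (ColRec⇒RowRecᵀ I J m s′ col′)
  where
  module Rows = RowRecurrences N N≢0 I J m tiling
  module Cols = RowRecurrences N N≢0 J I (transpose m) (IsNTiling-transpose I J m tiling)
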